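{- Let $X=(x_1,\dots,x_k)$ be a composition of a positive integer $n$. Then the number of Dyck words on 1s and 2s of length $2n$ whose type is $X$ equals the Motzkin number $M_{k-1}$.
   Context: A Dyck word on 1s and 2s of length $2n$ is a word with $n$ 1s and $n$ 2s such that every prefix contains at least as many 1s as 2s. For such a word $W$, call $i\in[n]$ selected if either the $i$-th 2 of $W$ is immediately followed by a 1, or the $i$-th 1 of $W$ is immediately followed by a 2. Let $s_1<\dots<s_k$ be the selected indices, and set $x_1=s_1$, $x_i=s_i-s_{i-1}$ for $2\le i\le k$; the type of $W$ is $(x_1,\dots,x_k)$ (a composition of $n$). The Motzkin number $M_m$ is the number of lattice paths from $(0,0)$ to $(m,0)$ with steps $(1,1)$, $(1,0)$, $(1,-1)$ that never go below the $x$-axis ($M_0=1$). -}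

module Defs where

open import Data.Nat using (ℕ; zero; suc; _+_; _*_; _∸_; _≡ᵇ_; _≤ᵇ_)
open import Data.Bool using (Bool; true; false; _∧_; _∨_; if_then_else_)
open import Data.List using (List; []; _∷_; length; map; concatMap; filterᵇ; inits; zipWith)
open import Data.Bool.ListAction using (and)

data Letter : Set where
  one two : Letter

isOne isTwo : Letter → Bool
isOne one = true
isOne two = false
isTwo one = false
isTwo two = true

count : {A : Set} → (A → Bool) → List A → ℕ
count p w = length (filterᵇ p w)

allWords : {A : Set} → List A → ℕ → List (List A)
allWords as zero = [] ∷ []
allWords as (suc m) = concatMap (λ a → map (a ∷_) (allWords as m)) as

isDyck : ℕ → List Letter → Bool
isDyck n w = (count isOne w ≡ᵇ n) ∧ (count isTwo w ≡ᵇ n)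
           ∧ and (map (λ p → count isTwo p ≤ᵇ count isOne p) (inits w))

followedBy : (Letter → Bool) → (Letter → Bool) → List Letter → List Bool
followedBy a b [] = []
followedBy a b (x ∷ []) = if a x then false ∷ [] else []
followedBy a b (x ∷ y ∷ w) = if a x then b y ∷ followedBy a b (y ∷ w) else followedBy a b (y ∷ w)

-- selected flags: the i-th entry says whether index i (1-based) is selected
selectedFlags : List Letter → List Bool
selectedFlags w = zipWith _∨_ (followedBy isTwo isOne w) (followedBy isOne isTwo w)

trueIndices : ℕ → List Bool → List ℕ
trueIndices i [] = []
trueIndices i (true ∷ bs) = i ∷ trueIndices (suc i) bs
trueIndices i (false ∷ bs) = trueIndices (suc i) bs

differences : ℕ → List ℕ → List ℕ
differences prev [] = []
differences prev (s ∷ ss) = (s ∸ prev) ∷ differences s ss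

type : List Letter → List ℕ
type w = differences 0 (trueIndices 1 (selectedFlags w))

listEqᵇ : List ℕ → List ℕ → Bool
listEqᵇ [] [] = true
listEqᵇ (x ∷ xs) (y ∷ ys) = (x ≡ᵇ y) ∧ listEqᵇ xs ys
listEqᵇ _ _ = false

numDyckOfType : ℕ → List ℕ → ℕ
numDyckOfType n X =
  length (filterᵇ (λ w → isDyck n w ∧ listEqᵇ (type w) X) (allWords (one ∷ two ∷ []) (2 * n)))

-- Motzkin paths: step sequences of length m (up (1,1), flat (1,0), down (1,-1))
-- ending on the x-axis and never going below it
data Step : Set where
  up flat down : Step

isUp isDown : Step → Bool
isUp up = true
isUp _ = false
isDown down = true
isDown _ = false

isMotzkinPath : List Step → Bool
isMotzkinPath p = (count isUp p ≡ᵇ count isDown p)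
                ∧ and (map (λ q → count isDown q ≤ᵇ count isUp q) (inits p))

motzkin : ℕ → ℕ
motzkin m = length (filterᵇ isMotzkinPath (allWords (up ∷ flat ∷ down ∷ []) m))

-- Write pᵢ for "the i-th 1 is followed by a 2" (a peak) and vᵢ for "the i-th 2 is followed by
-- a 1" (a valley); index i is selected iff (pᵢ , vᵢ) ≠ (false , false). A word starting with 1 is
-- recovered from the pair list z = ((p₁ , v₁) , … , (pₙ , vₙ)), and reading it letter by letter
-- shows that it is a Dyck word iff the walk on z with (false , true) = up, (true , true) = flat,
-- (true , false) = down and (false , false) = stay, started at height 1, first reaches 0 at its
-- last step. For a fixed type X the unselected pairs are forced, the last selected pair must be a
-- down step, and the other k - 1 selected pairs form an arbitrary Motzkin path; concretely, both
-- counts obey the Motzkin recurrence, split by the kind of the first selected pair.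
module Submission where

open import Defs
open import Data.Bool using (Bool; true; false; T; T?; _∧_; _∨_; not; if_then_else_)
open import Data.Bool.ListAction using (and; all)
open import Data.Bool.Properties using (T-∧; ∧-comm)
open import Data.Empty using (⊥-elim)
open import Data.List
  using (List; []; _∷_; _++_; [_]; _∷ʳ_; map; concatMap; length; null; inits; filterᵇ; zip; zipWith; unzip;
         cartesianProductWith)
open import Data.List.Properties
  using (length-++; ++-assoc; map-∘; map-cong; filter-++; filter-≐; filter-none; ∷-injective;
         zip-unzip; unzip-zip; length-unzipWith₁; length-unzipWith₂)
open import Data.List.Membership.Propositional using (_∈_)
open import Data.List.Membership.Propositional.Properties
  using (∈-∃++; ∈-++⁻; ∈-++⁺ˡ; ∈-++⁺ʳ; ∈-filter⁺; ∈-filter⁻;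
         ∈-cartesianProductWith⁺; ∈-cartesianProductWith⁻)
open import Data.List.Relation.Unary.All using (All; []; _∷_; tabulate)
import Data.List.Relation.Unary.All as All
open import Data.List.Relation.Unary.Any using (here; there)
open import Data.List.Relation.Unary.Unique.Propositional using (Unique; []; _∷_)
import Data.List.Relation.Unary.Unique.Propositional.Properties as Unique
open import Data.Maybe using (Maybe; just; nothing; maybe)
open import Data.Nat using (ℕ; zero; suc; _+_; _*_; _∸_; _<_; _≤_; _≡ᵇ_; _≤ᵇ_; z≤n; s≤s)
open import Data.Nat.ListAction using (sum)
open import Data.Nat.Properties
  using (+-comm; +-suc; +-identityʳ; suc-injective; ≤-refl; ≤-antisym; m≤n⇒m≤1+n; 1+n≰n; m+1+n≢m;
         m+n∸n≡m; ≡ᵇ⇒≡; ≡⇒≡ᵇ)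
open import Data.Product using (_×_; _,_; proj₁; proj₂; uncurry)
open import Data.Sum using (inj₁; inj₂)
open import Function using (_∘_; id)
open import Function.Bundles using (Equivalence)
open import Relation.Nullary using (¬_)
open import Relation.Binary.PropositionalEquality
  using (_≡_; refl; sym; trans; cong; cong₂; subst; module ≡-Reasoning)

open Equivalence using (to; from)

private variable
  A B : Set

≡ᵇ-refl : ∀ n → (n ≡ᵇ n) ≡ true
≡ᵇ-refl zero    = refl
≡ᵇ-refl (suc n) = ≡ᵇ-refl n

suc≤ᵇsuc : ∀ m n → (suc m ≤ᵇ suc n) ≡ (m ≤ᵇ n)
suc≤ᵇsuc zero    n = refl
suc≤ᵇsuc (suc m) n = refl

sucIf : Bool → ℕ → ℕ
sucIf b n = if b then suc n else n

count-∷ : (p : A → Bool) (x : A) (xs : List A) → count p (x ∷ xs) ≡ sucIf (p x) (count p xs)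
count-∷ p x xs with p x
... | true  = refl
... | false = refl

count-++ : (p : A → Bool) (xs ys : List A) → count p (xs ++ ys) ≡ count p xs + count p ys
count-++ p xs ys = trans (cong length (filter-++ (T? ∘ p) xs ys)) (length-++ (filterᵇ p xs))

count-∷ʳ : (p : A → Bool) (xs : List A) (x : A) → count p (xs ∷ʳ x) ≡ count p (x ∷ xs)
count-∷ʳ p xs x = begin
  count p (xs ∷ʳ x)          ≡⟨ count-++ p xs [ x ] ⟩
  count p xs + count p [ x ] ≡⟨ +-comm (count p xs) _ ⟩
  count p [ x ] + count p xs ≡⟨ count-++ p [ x ] xs ⟨
  count p (x ∷ xs)           ∎
  where open ≡-Reasoning

count-map : (p : B → Bool) (f : A → B) (xs : List A) → count p (map f xs) ≡ count (p ∘ f) xs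
count-map p f []       = refl
count-map p f (x ∷ xs) with p (f x)
... | true  = cong suc (count-map p f xs)
... | false = count-map p f xs

count-cong : {p q : A → Bool} → (∀ x → p x ≡ q x) → (xs : List A) → count p xs ≡ count q xs
count-cong p≡q xs = cong length (filter-≐ (T? ∘ _) (T? ∘ _)
  ((λ {x} → subst T (p≡q x)) , (λ {x} → subst T (sym (p≡q x)))) xs)

count-none : (p : A → Bool) (xs : List A) → (∀ {x} → x ∈ xs → ¬ T (p x)) → count p xs ≡ 0
count-none p xs none = cong length (filter-none (T? ∘ p) (tabulate none))

length-mono-injection : {xs : List A} {ys : List B} → Unique xs → (f : A → B) (g : B → A) →
  (∀ {x} → x ∈ xs → f x ∈ ys × g (f x) ≡ x) → length xs ≤ length ys
length-mono-injection []                 f g embed = z≤n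
length-mono-injection {xs = x ∷ xs} (x∉xs ∷ xs!) f g embed
  with ys₁ , ys₂ , refl ← ∈-∃++ (proj₁ (embed (here refl))) =
  subst (suc (length xs) ≤_) (sym length-middle) (s≤s (length-mono-injection xs! f g embed′))
  where
  length-middle : length (ys₁ ++ f x ∷ ys₂) ≡ suc (length (ys₁ ++ ys₂))
  length-middle = trans (length-++ ys₁) (trans (+-suc (length ys₁) _) (cong suc (sym (length-++ ys₁))))
  embed′ : ∀ {y} → y ∈ xs → f y ∈ ys₁ ++ ys₂ × g (f y) ≡ y
  embed′ {y} y∈ with ∈-++⁻ ys₁ (proj₁ (embed (there y∈)))
  ... | inj₁ fy∈ys₁         = ∈-++⁺ˡ fy∈ys₁ , proj₂ (embed (there y∈))
  ... | inj₂ (there fy∈ys₂) = ∈-++⁺ʳ ys₁ fy∈ys₂ , proj₂ (embed (there y∈))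
  ... | inj₂ (here fy≡fx)   = ⊥-elim (All.lookup x∉xs y∈ x≡y)
    where
    x≡y : x ≡ y
    x≡y = trans (sym (proj₂ (embed (here refl)))) (trans (cong g (sym fy≡fx)) (proj₂ (embed (there y∈))))

count-mono-injection : {p : A → Bool} {q : B → Bool} {xs : List A} {ys : List B} →
  Unique xs → (f : A → B) (g : B → A) →
  (∀ {x} → x ∈ xs → T (p x) → f x ∈ ys × T (q (f x)) × g (f x) ≡ x) → count p xs ≤ count q ys
count-mono-injection {p = p} {q} {xs} xs! f g embed =
  length-mono-injection (Unique.filter⁺ (T? ∘ p) xs!) f g λ x∈ →
    let x∈xs , px = ∈-filter⁻ (T? ∘ p) {xs = xs} x∈
        fx∈ys , qfx , gfx≡x = embed x∈xs px
    in ∈-filter⁺ (T? ∘ q) fx∈ys qfx , gfx≡x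

count-bijection : {p : A → Bool} {q : B → Bool} {xs : List A} {ys : List B} →
  Unique xs → Unique ys → (f : A → B) (g : B → A) →
  (∀ {x} → x ∈ xs → T (p x) → f x ∈ ys × T (q (f x)) × g (f x) ≡ x) →
  (∀ {y} → y ∈ ys → T (q y) → g y ∈ xs × T (p (g y)) × f (g y) ≡ y) →
  count p xs ≡ count q ys
count-bijection xs! ys! f g f-embed g-embed =
  ≤-antisym (count-mono-injection xs! f g f-embed) (count-mono-injection ys! g f g-embed)

allWords-suc : (as : List A) (m : ℕ) → allWords as (suc m) ≡ cartesianProductWith _∷_ as (allWords as m)
allWords-suc as m = prepend-each as
  where
  prepend-each : (bs : List _) → concatMap (λ b → map (b ∷_) (allWords as m)) bs
                                   ≡ cartesianProductWith _∷_ bs (allWords as m)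
  prepend-each []       = refl
  prepend-each (b ∷ bs) = cong (map (b ∷_) (allWords as m) ++_) (prepend-each bs)

allWords-unique : {as : List A} → Unique as → (m : ℕ) → Unique (allWords as m)
allWords-unique           as! zero    = [] ∷ []
allWords-unique {as = as} as! (suc m) = subst Unique (sym (allWords-suc as m))
  (Unique.cartesianProductWith⁺ _∷_ ∷-injective as! (allWords-unique as! m))

∈-allWords : {as : List A} → (∀ a → a ∈ as) → (w : List A) → w ∈ allWords as (length w)
∈-allWords           every []      = here refl
∈-allWords {as = as} every (a ∷ w) = subst (a ∷ w ∈_) (sym (allWords-suc as (length w)))
  (∈-cartesianProductWith⁺ _∷_ (every a) (∈-allWords every w))

∈-allWords⇒length : {as : List A} (m : ℕ) {w : List A} → w ∈ allWords as m → length w ≡ m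
∈-allWords⇒length zero (here refl) = refl
∈-allWords⇒length {as = as} (suc m) w∈
  with ∈-cartesianProductWith⁻ _∷_ as (allWords as m) (subst (_ ∈_) (allWords-suc as m) w∈)
... | _ , _ , _ , w′∈ , refl = cong suc (∈-allWords⇒length m w′∈)

count-allWords-suc : (p : List A → Bool) (as : List A) (m : ℕ) →
  count p (allWords as (suc m)) ≡ sum (map (λ a → count (p ∘ (a ∷_)) (allWords as m)) as)
count-allWords-suc p as m = trans (cong (count p) (allWords-suc as m)) (split as)
  where
  split : (bs : List _) → count p (cartesianProductWith _∷_ bs (allWords as m))
                          ≡ sum (map (λ b → count (p ∘ (b ∷_)) (allWords as m)) bs)
  split []       = refl
  split (b ∷ bs) = trans (count-++ p (map (b ∷_) (allWords as m)) _)
                         (cong₂ _+_ (count-map p (b ∷_) (allWords as m)) (split bs))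

move : Bool → Bool → ℕ → Maybe ℕ
move true  false h       = just (suc h)
move false true  zero    = nothing
move false true  (suc h) = just h
move _     _     h       = just h

module _ (rise fall : A → Bool) where

  excursion : ℕ → List A → Bool
  excursion h []      = h ≡ᵇ 0
  excursion h (x ∷ w) = maybe (λ h′ → excursion h′ w) false (move (rise x) (fall x) h)

  prefixesAbove : ℕ → List A → Bool
  prefixesAbove h w = and (map (λ q → count fall q ≤ᵇ h + count rise q) (inits w))

  private
    prefixesAbove-∷ : ∀ h x w → prefixesAbove h (x ∷ w)
      ≡ and (map (λ q → sucIf (fall x) (count fall q) ≤ᵇ h + sucIf (rise x) (count rise q)) (inits w))
    prefixesAbove-∷ h x w = trans (cong and (sym (map-∘ (inits w))))
      (cong and (map-cong (λ q → cong₂ (λ c d → c ≤ᵇ h + d) (count-∷ fall x q) (count-∷ rise x q)) (inits w)))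

  excursion-prefixes : ∀ h w → (prefixesAbove h w ∧ (h + count rise w ≡ᵇ count fall w)) ≡ excursion h w
  private
    excursion-prefixes-step : ∀ a b h w →
      (and (map (λ q → sucIf b (count fall q) ≤ᵇ h + sucIf a (count rise q)) (inits w))
        ∧ (h + sucIf a (count rise w) ≡ᵇ sucIf b (count fall w)))
      ≡ maybe (λ h′ → excursion h′ w) false (move a b h)
    excursion-prefixes-step true false h w =
      trans (cong₂ _∧_ (cong and (map-cong (λ q → cong (count fall q ≤ᵇ_) (+-suc h (count rise q))) (inits w)))
                       (cong (_≡ᵇ count fall w) (+-suc h (count rise w))))
            (excursion-prefixes (suc h) w)
    excursion-prefixes-step false true zero    w = refl
    excursion-prefixes-step false true (suc h) w =
      trans (cong (_∧ (h + count rise w ≡ᵇ count fall w))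
                  (cong and (map-cong (λ q → suc≤ᵇsuc (count fall q) (h + count rise q)) (inits w))))
            (excursion-prefixes h w)
    excursion-prefixes-step true true h w =
      trans (cong₂ _∧_ (cong and (map-cong (λ q → trans (cong (suc (count fall q) ≤ᵇ_) (+-suc h (count rise q)))
                                                          (suc≤ᵇsuc (count fall q) (h + count rise q)))
                                            (inits w)))
                       (cong (_≡ᵇ suc (count fall w)) (+-suc h (count rise w))))
            (excursion-prefixes h w)
    excursion-prefixes-step false false h w = excursion-prefixes h w

  excursion-prefixes h []      = cong (_≡ᵇ 0) (+-identityʳ h)
  excursion-prefixes h (x ∷ w) =
    trans (cong₂ _∧_ (prefixesAbove-∷ h x w) (cong₂ (λ c d → h + c ≡ᵇ d) (count-∷ rise x w) (count-∷ fall x w)))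
          (excursion-prefixes-step (rise x) (fall x) h w)

isDyck⇒excursion : ∀ {n} w → T (isDyck n w) →
  T (excursion isOne isTwo 0 w) × count isOne w ≡ n × count isTwo w ≡ n
isDyck⇒excursion {n} w dyck
  with ones , rest  ← to (T-∧ {count isOne w ≡ᵇ n}) dyck
  with twos , above ← to (T-∧ {count isTwo w ≡ᵇ n} {prefixesAbove isOne isTwo 0 w}) rest
  = subst T (excursion-prefixes isOne isTwo 0 w) (from T-∧ (above , ≡⇒≡ᵇ _ _ (trans ones≡n (sym twos≡n)))) ,
    ones≡n , twos≡n
  where
  ones≡n : count isOne w ≡ n
  ones≡n = ≡ᵇ⇒≡ (count isOne w) n ones
  twos≡n : count isTwo w ≡ n
  twos≡n = ≡ᵇ⇒≡ (count isTwo w) n twos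

excursion⇒isDyck : ∀ {n} w → T (excursion isOne isTwo 0 w) → count isOne w ≡ n → count isTwo w ≡ n →
  T (isDyck n w)
excursion⇒isDyck {n} w exc ones twos =
  from T-∧ (≡⇒≡ᵇ _ n ones , from T-∧ (≡⇒≡ᵇ _ n twos , above))
  where
  above : T (prefixesAbove isOne isTwo 0 w)
  above = proj₁ (to (T-∧ {prefixesAbove isOne isTwo 0 w}) (subst T (sym (excursion-prefixes isOne isTwo 0 w)) exc))

peakFlags valleyFlags : List Letter → List Bool
peakFlags   = followedBy isOne isTwo
valleyFlags = followedBy isTwo isOne

length-peakFlags : ∀ w → length (peakFlags w) ≡ count isOne w
length-peakFlags []              = refl
length-peakFlags (one ∷ [])      = refl
length-peakFlags (two ∷ [])      = refl
length-peakFlags (one ∷ one ∷ w) = cong suc (length-peakFlags (one ∷ w))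
length-peakFlags (one ∷ two ∷ w) = cong suc (length-peakFlags (two ∷ w))
length-peakFlags (two ∷ one ∷ w) = length-peakFlags (one ∷ w)
length-peakFlags (two ∷ two ∷ w) = length-peakFlags (two ∷ w)

length-valleyFlags : ∀ w → length (valleyFlags w) ≡ count isTwo w
length-valleyFlags []              = refl
length-valleyFlags (one ∷ [])      = refl
length-valleyFlags (two ∷ [])      = refl
length-valleyFlags (one ∷ one ∷ w) = length-valleyFlags (one ∷ w)
length-valleyFlags (one ∷ two ∷ w) = length-valleyFlags (two ∷ w)
length-valleyFlags (two ∷ one ∷ w) = cong suc (length-valleyFlags (one ∷ w))
length-valleyFlags (two ∷ two ∷ w) = cong suc (length-valleyFlags (two ∷ w))

length≡ones+twos : ∀ w → length w ≡ count isOne w + count isTwo w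
length≡ones+twos []        = refl
length≡ones+twos (one ∷ w) = cong suc (length≡ones+twos w)
length≡ones+twos (two ∷ w) = trans (cong suc (length≡ones+twos w)) (sym (+-suc (count isOne w) (count isTwo w)))

-- valid↑ d P V: the word with peak flags P and valley flags V, read from a 1 at height d
-- (valid↓: from a 2), stays at height ≥ 0 and ends at height 0. decode↑/decode↓ rebuild that word.
valid↑ valid↓ : ℕ → List Bool → List Bool → Bool
valid↑ d []          V = false
valid↑ d (false ∷ P) V = valid↑ (suc d) P V
valid↑ d (true  ∷ P) V = valid↓ (suc d) P V
valid↓ d       P []          = (d ≡ᵇ 0) ∧ null P
valid↓ zero    P (_ ∷ _)     = false
valid↓ (suc d) P (false ∷ V) = valid↓ d P V
valid↓ (suc d) P (true  ∷ V) = valid↑ d P V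

decode↑ decode↓ : List Bool → List Bool → List Letter
decode↑ []          V = []
decode↑ (false ∷ P) V = one ∷ decode↑ P V
decode↑ (true  ∷ P) V = one ∷ decode↓ P V
decode↓ P []          = []
decode↓ P (false ∷ V) = two ∷ decode↓ P V
decode↓ P (true  ∷ V) = two ∷ decode↑ P V

excursion≡valid↑ : ∀ d w →
  excursion isOne isTwo d (one ∷ w) ≡ valid↑ d (peakFlags (one ∷ w)) (valleyFlags (one ∷ w))
excursion≡valid↓ : ∀ d w →
  excursion isOne isTwo d (two ∷ w) ≡ valid↓ d (peakFlags (two ∷ w)) (valleyFlags (two ∷ w))
excursion≡valid↑ d []        = refl
excursion≡valid↑ d (one ∷ w) = excursion≡valid↑ (suc d) w
excursion≡valid↑ d (two ∷ w) = excursion≡valid↓ (suc d) w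
excursion≡valid↓ zero          []        = refl
excursion≡valid↓ (suc zero)    []        = refl
excursion≡valid↓ (suc (suc d)) []        = refl
excursion≡valid↓ zero          (_ ∷ w)   = refl
excursion≡valid↓ (suc d)       (one ∷ w) = excursion≡valid↑ d w
excursion≡valid↓ (suc d)       (two ∷ w) = excursion≡valid↓ d w

decode↑-flags : ∀ w → decode↑ (peakFlags (one ∷ w)) (valleyFlags (one ∷ w)) ≡ one ∷ w
decode↓-flags : ∀ w → decode↓ (peakFlags (two ∷ w)) (valleyFlags (two ∷ w)) ≡ two ∷ w
decode↑-flags []        = refl
decode↑-flags (one ∷ w) = cong (one ∷_) (decode↑-flags w)
decode↑-flags (two ∷ w) = cong (one ∷_) (decode↓-flags w)
decode↓-flags []        = refl
decode↓-flags (one ∷ w) = cong (two ∷_) (decode↑-flags w)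
decode↓-flags (two ∷ w) = cong (two ∷_) (decode↓-flags w)

flags-decode↑ : ∀ d P V → T (valid↑ d P V) →
  peakFlags (decode↑ P V) ≡ P × valleyFlags (decode↑ P V) ≡ V
flags-decode↓ : ∀ d P V → T (valid↓ d P V) →
  peakFlags (decode↓ P V) ≡ P × valleyFlags (decode↓ P V) ≡ V
flags-decode↑ d (false ∷ false ∷ P) V ok
  with P≡ , V≡ ← flags-decode↑ (suc d) (false ∷ P) V ok = cong (false ∷_) P≡ , V≡
flags-decode↑ d (false ∷ true ∷ P) V ok
  with P≡ , V≡ ← flags-decode↑ (suc d) (true ∷ P) V ok = cong (false ∷_) P≡ , V≡
flags-decode↑ d (true ∷ P) (false ∷ V) ok
  with P≡ , V≡ ← flags-decode↓ (suc d) P (false ∷ V) ok = cong (true ∷_) P≡ , V≡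
flags-decode↑ d (true ∷ P) (true ∷ V) ok
  with P≡ , V≡ ← flags-decode↓ (suc d) P (true ∷ V) ok = cong (true ∷_) P≡ , V≡
flags-decode↓ zero       [] []           ok = refl , refl
flags-decode↓ (suc zero) [] (false ∷ []) ok = refl , refl
flags-decode↓ (suc d) P (false ∷ false ∷ V) ok
  with P≡ , V≡ ← flags-decode↓ d P (false ∷ V) ok = P≡ , cong (false ∷_) V≡
flags-decode↓ (suc d) P (false ∷ true ∷ V) ok
  with P≡ , V≡ ← flags-decode↓ d P (true ∷ V) ok = P≡ , cong (false ∷_) V≡
flags-decode↓ (suc d) (false ∷ P) (true ∷ V) ok
  with P≡ , V≡ ← flags-decode↑ d (false ∷ P) V ok = P≡ , cong (true ∷_) V≡
flags-decode↓ (suc d) (true ∷ P) (true ∷ V) ok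
  with P≡ , V≡ ← flags-decode↑ d (true ∷ P) V ok = P≡ , cong (true ∷_) V≡

excursion-decode↑ : ∀ d P V → T (valid↑ d P V) → excursion isOne isTwo d (decode↑ P V) ≡ valid↑ d P V
excursion-decode↑ d (false ∷ P) V ok with P≡ , V≡ ← flags-decode↑ d (false ∷ P) V ok =
  trans (excursion≡valid↑ d (decode↑ P V)) (cong₂ (valid↑ d) P≡ V≡)
excursion-decode↑ d (true ∷ P) V ok with P≡ , V≡ ← flags-decode↑ d (true ∷ P) V ok =
  trans (excursion≡valid↑ d (decode↓ P V)) (cong₂ (valid↑ d) P≡ V≡)

hitsZeroLast : ℕ → List (Bool × Bool) → Bool
hitsZeroLast h       []                    = h ≡ᵇ 0
hitsZeroLast zero    (_ ∷ _)               = false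
hitsZeroLast (suc h) ((false , false) ∷ z) = hitsZeroLast (suc h) z
hitsZeroLast (suc h) ((false , true)  ∷ z) = hitsZeroLast (suc (suc h)) z
hitsZeroLast (suc h) ((true  , true)  ∷ z) = hitsZeroLast (suc h) z
hitsZeroLast (suc h) ((true  , false) ∷ z) = hitsZeroLast h z

private
  enqueue : (f : ℕ → List Bool → Bool) (V₀ : List Bool) (v : Bool) (V₁ : List Bool) →
            f (suc (length V₀)) (V₀ ++ v ∷ V₁) ≡ f (length (V₀ ∷ʳ v)) ((V₀ ∷ʳ v) ++ V₁)
  enqueue f V₀ v V₁ = sym (cong₂ f (trans (length-++ V₀) (+-comm (length V₀) 1)) (++-assoc V₀ [ v ] V₁))

-- After the i-th 1 has been read, V₀ is the queue of valley flags of the 2s of index ≤ i not yet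
-- read: the height is its length, and the walk on pairs tracks its number of valleys.
valid↑-pending : ∀ P V₀ V₁ → length V₁ ≡ length P →
  valid↑ (length V₀) P (V₀ ++ V₁) ≡ hitsZeroLast (suc (count id V₀)) (zip P V₁)
valid↓-pending : ∀ P V₀ V₁ → length V₁ ≡ length P →
  valid↓ (length V₀) P (V₀ ++ V₁) ≡ hitsZeroLast (count id V₀) (zip P V₁)
valid↑-pending []          V₀ []          _ = refl
valid↑-pending (false ∷ P) V₀ (false ∷ V₁) l = trans (enqueue (λ d V → valid↑ d P V) V₀ false V₁)
  (trans (valid↑-pending P (V₀ ∷ʳ false) V₁ (suc-injective l))
         (cong (λ c → hitsZeroLast (suc c) (zip P V₁)) (count-∷ʳ id V₀ false)))
valid↑-pending (false ∷ P) V₀ (true ∷ V₁)  l = trans (enqueue (λ d V → valid↑ d P V) V₀ true V₁)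
  (trans (valid↑-pending P (V₀ ∷ʳ true) V₁ (suc-injective l))
         (cong (λ c → hitsZeroLast (suc c) (zip P V₁)) (count-∷ʳ id V₀ true)))
valid↑-pending (true ∷ P)  V₀ (false ∷ V₁) l = trans (enqueue (λ d V → valid↓ d P V) V₀ false V₁)
  (trans (valid↓-pending P (V₀ ∷ʳ false) V₁ (suc-injective l))
         (cong (λ c → hitsZeroLast c (zip P V₁)) (count-∷ʳ id V₀ false)))
valid↑-pending (true ∷ P)  V₀ (true ∷ V₁)  l = trans (enqueue (λ d V → valid↓ d P V) V₀ true V₁)
  (trans (valid↓-pending P (V₀ ∷ʳ true) V₁ (suc-injective l))
         (cong (λ c → hitsZeroLast c (zip P V₁)) (count-∷ʳ id V₀ true)))
valid↓-pending []      []           []      _ = refl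
valid↓-pending (_ ∷ _) []           (_ ∷ _) _ = refl
valid↓-pending P       (false ∷ V₀) V₁      l = valid↓-pending P V₀ V₁ l
valid↓-pending P       (true ∷ V₀)  V₁      l = valid↑-pending P V₀ V₁ l

-- hasGaps g X F: the positions of true in F have successive gaps X, where g positions of the
-- first gap already lie before F.
hasGaps : ℕ → List ℕ → List Bool → Bool
hasGaps g []      F           = all not F
hasGaps g (x ∷ X) []          = false
hasGaps g (x ∷ X) (false ∷ F) = hasGaps (suc g) (x ∷ X) F
hasGaps g (x ∷ X) (true  ∷ F) = (suc g ≡ᵇ x) ∧ hasGaps 0 X F

differences≡hasGaps : ∀ g p F X → listEqᵇ (differences p (trueIndices (suc (g + p)) F)) X ≡ hasGaps g X F
differences≡hasGaps g p []          []      = refl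
differences≡hasGaps g p []          (x ∷ X) = refl
differences≡hasGaps g p (false ∷ F) []      = differences≡hasGaps (suc g) p F []
differences≡hasGaps g p (false ∷ F) (x ∷ X) = differences≡hasGaps (suc g) p F (x ∷ X)
differences≡hasGaps g p (true ∷ F)  []      = refl
differences≡hasGaps g p (true ∷ F)  (x ∷ X) =
  cong₂ _∧_ (cong (_≡ᵇ x) (m+n∸n≡m (suc g) p)) (differences≡hasGaps 0 (suc (g + p)) F X)

type≡hasGaps : ∀ w X → listEqᵇ (type w) X ≡ hasGaps 0 X (selectedFlags w)
type≡hasGaps w = differences≡hasGaps 0 0 (selectedFlags w)

hasGaps-select : ∀ {g x} X F → T (hasGaps g (x ∷ X) (true ∷ F)) → suc g ≡ x
hasGaps-select {g} {x} X F t = ≡ᵇ⇒≡ (suc g) x (proj₁ (to T-∧ t))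

hasGaps-overshot : ∀ {g x} X F → x ≤ g → ¬ T (hasGaps g (x ∷ X) F)
hasGaps-overshot     X (false ∷ F) x≤g t = hasGaps-overshot X F (m≤n⇒m≤1+n x≤g) t
hasGaps-overshot {g} X (true ∷ F)  x≤g t = 1+n≰n (subst (_≤ g) (sym (hasGaps-select X F t)) x≤g)

letters : List Letter
letters = one ∷ two ∷ []

pairs : List (Bool × Bool)
pairs = (false , false) ∷ (false , true) ∷ (true , true) ∷ (true , false) ∷ []

∈-letters : ∀ a → a ∈ letters
∈-letters one = here refl
∈-letters two = there (here refl)

∈-pairs : ∀ a → a ∈ pairs
∈-pairs (false , false) = here refl
∈-pairs (false , true)  = there (here refl)
∈-pairs (true  , true)  = there (there (here refl))
∈-pairs (true  , false) = there (there (there (here refl)))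

letters-unique : Unique letters
letters-unique = ((λ ()) ∷ []) ∷ [] ∷ []

pairs-unique : Unique pairs
pairs-unique = ((λ ()) ∷ (λ ()) ∷ (λ ()) ∷ []) ∷ ((λ ()) ∷ (λ ()) ∷ []) ∷ ((λ ()) ∷ []) ∷ [] ∷ []

encode : List Letter → List (Bool × Bool)
encode w = zip (peakFlags w) (valleyFlags w)

decode : List (Bool × Bool) → List Letter
decode z = uncurry decode↑ (unzip z)

selected : List (Bool × Bool) → List Bool
selected z = uncurry (λ P V → zipWith _∨_ V P) (unzip z)

pairCount : ℕ → ℕ → List ℕ → ℕ → ℕ
pairCount h g X m = count (λ z → hitsZeroLast h z ∧ hasGaps g X (selected z)) (allWords pairs m)

encode-dyckOfType : ∀ {n} X w → 0 < n → T (isDyck n w ∧ listEqᵇ (type w) X) →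
  encode w ∈ allWords pairs n × T (hitsZeroLast 1 (encode w) ∧ hasGaps 0 X (selected (encode w))) ×
  decode (encode w) ≡ w
encode-dyckOfType {suc _} X []        _ ()
encode-dyckOfType         X (two ∷ w) _ ok = ⊥-elim (proj₁ (isDyck⇒excursion (two ∷ w) (proj₁ (to T-∧ ok))))
encode-dyckOfType {n}     X (one ∷ w) _ ok
  with dyck , typed      ← to (T-∧ {isDyck n (one ∷ w)}) ok
  with exc , ones , twos ← isDyck⇒excursion (one ∷ w) dyck
  = member , from T-∧ (walk , gaps) , decoded
  where
  P V : List Bool
  P = peakFlags (one ∷ w)
  V = valleyFlags (one ∷ w)
  P-length : length P ≡ n
  P-length = trans (length-peakFlags (one ∷ w)) ones
  V-length : length V ≡ n
  V-length = trans (length-valleyFlags (one ∷ w)) twos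
  unzipped : unzip (zip P V) ≡ (P , V)
  unzipped = unzip-zip P V (trans P-length (sym V-length))
  member : encode (one ∷ w) ∈ allWords pairs n
  member = subst (λ m → encode (one ∷ w) ∈ allWords pairs m)
    (trans (sym (length-unzipWith₁ id (zip P V))) (trans (cong (length ∘ proj₁) unzipped) P-length))
    (∈-allWords ∈-pairs (encode (one ∷ w)))
  walk : T (hitsZeroLast 1 (encode (one ∷ w)))
  walk = subst T (trans (excursion≡valid↑ 0 w) (valid↑-pending P [] V (trans V-length (sym P-length)))) exc
  gaps : T (hasGaps 0 X (selected (encode (one ∷ w))))
  gaps = subst T (trans (type≡hasGaps (one ∷ w) X)
                        (cong (hasGaps 0 X ∘ uncurry (λ P V → zipWith _∨_ V P)) (sym unzipped)))
                 typed
  decoded : decode (encode (one ∷ w)) ≡ one ∷ w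
  decoded = trans (cong (uncurry decode↑) unzipped) (decode↑-flags w)

decode-pairsOfType : ∀ {n} X z → z ∈ allWords pairs n → T (hitsZeroLast 1 z ∧ hasGaps 0 X (selected z)) →
  decode z ∈ allWords letters (2 * n) × T (isDyck n (decode z) ∧ listEqᵇ (type (decode z)) X) ×
  encode (decode z) ≡ z
decode-pairsOfType {n} X z z∈ ok = member , from T-∧ (dyck , typed) , trans (cong₂ zip P≡ V≡) (zip-unzip z)
  where
  P V : List Bool
  P = proj₁ (unzip z)
  V = proj₂ (unzip z)
  P-length : length P ≡ n
  P-length = trans (length-unzipWith₁ id z) (∈-allWords⇒length n z∈)
  V-length : length V ≡ n
  V-length = trans (length-unzipWith₂ id z) (∈-allWords⇒length n z∈)
  walk×gaps : T (hitsZeroLast 1 z) × T (hasGaps 0 X (selected z))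
  walk×gaps = to T-∧ ok
  valid : T (valid↑ 0 P V)
  valid = subst T (sym (trans (valid↑-pending P [] V (trans V-length (sym P-length)))
                              (cong (hitsZeroLast 1) (zip-unzip z))))
                  (proj₁ walk×gaps)
  P≡ : peakFlags (decode z) ≡ P
  P≡ = proj₁ (flags-decode↑ 0 P V valid)
  V≡ : valleyFlags (decode z) ≡ V
  V≡ = proj₂ (flags-decode↑ 0 P V valid)
  ones : count isOne (decode z) ≡ n
  ones = trans (sym (length-peakFlags (decode z))) (trans (cong length P≡) P-length)
  twos : count isTwo (decode z) ≡ n
  twos = trans (sym (length-valleyFlags (decode z))) (trans (cong length V≡) V-length)
  dyck : T (isDyck n (decode z))
  dyck = excursion⇒isDyck (decode z) (subst T (sym (excursion-decode↑ 0 P V valid)) valid) ones twos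
  typed : T (listEqᵇ (type (decode z)) X)
  typed = subst T (sym (trans (type≡hasGaps (decode z) X)
                              (cong₂ (λ P′ V′ → hasGaps 0 X (zipWith _∨_ V′ P′)) P≡ V≡)))
                  (proj₂ walk×gaps)
  member : decode z ∈ allWords letters (2 * n)
  member = subst (λ m → decode z ∈ allWords letters m)
    (trans (length≡ones+twos (decode z)) (trans (cong₂ _+_ ones twos) (cong (n +_) (sym (+-identityʳ n)))))
    (∈-allWords ∈-letters (decode z))

numDyckOfType≡pairCount : ∀ {n} X → 0 < n → numDyckOfType n X ≡ pairCount 1 0 X n
numDyckOfType≡pairCount {n} X 0<n =
  count-bijection (allWords-unique letters-unique (2 * n)) (allWords-unique pairs-unique n) encode decode
    (λ {w} _ → encode-dyckOfType X w 0<n) (λ {z} → decode-pairsOfType X z)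

pairCount-stuck : ∀ g X m → pairCount 0 g X (suc m) ≡ 0
pairCount-stuck g X m =
  count-none _ (allWords pairs (suc m)) λ {z} z∈ → stuck z (∈-allWords⇒length (suc m) z∈)
  where
  stuck : ∀ z → length z ≡ suc m → ¬ T (hitsZeroLast 0 z ∧ hasGaps g X (selected z))
  stuck (_ ∷ _) _ ()

-- The summands on the right are the words whose first selected pair is an up, flat or down step.
pairCount-gap : ∀ e g k X m → pairCount (suc e) g (suc (g + k) ∷ X) (suc k + m)
  ≡ pairCount (suc (suc e)) 0 X m + (pairCount (suc e) 0 X m + (pairCount e 0 X m + 0))
pairCount-gap e g zero X m rewrite +-identityʳ g =
  trans (count-allWords-suc _ pairs m)
        (cong₂ _+_ overshot (cong₂ _+_ (selectHere (suc (suc e)))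
                            (cong₂ _+_ (selectHere (suc e)) (cong₂ _+_ (selectHere e) refl))))
  where
  overshot : count (λ z → hitsZeroLast (suc e) z ∧ hasGaps (suc g) (suc g ∷ X) (selected z)) (allWords pairs m) ≡ 0
  overshot = count-none _ (allWords pairs m) λ {z} _ t → hasGaps-overshot X (selected z) ≤-refl (proj₂ (to T-∧ t))
  selectHere : ∀ h → count (λ z → hitsZeroLast h z ∧ ((g ≡ᵇ g) ∧ hasGaps 0 X (selected z))) (allWords pairs m)
                     ≡ pairCount h 0 X m
  selectHere h = count-cong (λ z → cong (λ b → hitsZeroLast h z ∧ (b ∧ hasGaps 0 X (selected z))) (≡ᵇ-refl g))
                            (allWords pairs m)
pairCount-gap e g (suc k) X m =
  trans (count-allWords-suc _ pairs (suc k + m))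
        (trans (cong₂ _+_ (trans shift (pairCount-gap e (suc g) k X m))
                          (cong₂ _+_ (tooEarly (suc (suc e)))
                                     (cong₂ _+_ (tooEarly (suc e)) (cong₂ _+_ (tooEarly e) refl))))
               (+-identityʳ _))
  where
  shift : count (λ z → hitsZeroLast (suc e) z ∧ hasGaps (suc g) (suc (g + suc k) ∷ X) (selected z))
                (allWords pairs (suc k + m))
        ≡ pairCount (suc e) (suc g) (suc (suc g + k) ∷ X) (suc k + m)
  shift = cong (λ x → pairCount (suc e) (suc g) (suc x ∷ X) (suc k + m)) (+-suc g k)
  tooEarly : ∀ h → count (λ z → hitsZeroLast h z ∧ hasGaps g (suc (g + suc k) ∷ X) (true ∷ selected z))
                         (allWords pairs (suc k + m)) ≡ 0
  tooEarly h = count-none _ (allWords pairs (suc k + m)) λ {z} _ t →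
    m+1+n≢m g (sym (suc-injective (hasGaps-select X (selected z) (proj₂ (to (T-∧ {hitsZeroLast h z}) t)))))

steps : List Step
steps = up ∷ flat ∷ down ∷ []

motzkinFrom : ℕ → ℕ → ℕ
motzkinFrom h m = count (excursion isUp isDown h) (allWords steps m)

motzkin≡motzkinFrom : ∀ m → motzkin m ≡ motzkinFrom 0 m
motzkin≡motzkinFrom m =
  count-cong (λ p → trans (∧-comm (count isUp p ≡ᵇ count isDown p) (prefixesAbove isUp isDown 0 p))
                          (excursion-prefixes isUp isDown 0 p))
             (allWords steps m)

-- The pair walk runs one level above the Motzkin path, whose steps are the selected pairs except
-- the last one, the final descent to 0.
pairCount≡motzkinFrom : ∀ e {x X} → All (0 <_) (x ∷ X) →
  pairCount (suc e) 0 (x ∷ X) (sum (x ∷ X)) ≡ motzkinFrom e (length X)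
pairCount≡motzkinFrom e {suc k} {[]} (_ ∷ []) = trans (pairCount-gap e 0 k [] 0) (lastStep e)
  where
  lastStep : ∀ e → pairCount (suc (suc e)) 0 [] 0 + (pairCount (suc e) 0 [] 0 + (pairCount e 0 [] 0 + 0))
                   ≡ motzkinFrom e 0
  lastStep zero    = refl
  lastStep (suc e) = refl
pairCount≡motzkinFrom e {suc k} {X@(suc k′ ∷ X′)} (_ ∷ X>0@(s≤s _ ∷ _)) = begin
  pairCount (suc e) 0 (suc k ∷ X) (suc k + sum X)
    ≡⟨ pairCount-gap e 0 k X (sum X) ⟩
  pairCount (suc (suc e)) 0 X (sum X) + (pairCount (suc e) 0 X (sum X) + (pairCount e 0 X (sum X) + 0))
    ≡⟨ cong₂ _+_ (pairCount≡motzkinFrom (suc e) X>0)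
                 (cong₂ _+_ (pairCount≡motzkinFrom e X>0) (cong (_+ 0) (downStep e))) ⟩
  motzkinFrom (suc e) L + (motzkinFrom e L + (count (excursion isUp isDown e ∘ (down ∷_)) (allWords steps L) + 0))
    ≡⟨ count-allWords-suc (excursion isUp isDown e) steps L ⟨
  motzkinFrom e (suc L) ∎
  where
  open ≡-Reasoning
  L : ℕ
  L = length X′
  downStep : ∀ e → pairCount e 0 X (sum X) ≡ count (excursion isUp isDown e ∘ (down ∷_)) (allWords steps L)
  downStep zero    = trans (pairCount-stuck 0 X (k′ + sum X′)) (sym (count-none _ (allWords steps L) λ _ ()))
  downStep (suc e) = pairCount≡motzkinFrom e X>0

lemma3p6 : (n : ℕ) → 0 < n → (X : List ℕ) → All (0 <_) X → sum X ≡ n →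
    numDyckOfType n X ≡ motzkin (length X ∸ 1)
lemma3p6 _ () [] _ refl
lemma3p6 n 0<n (x ∷ X) X>0 refl = begin
  numDyckOfType n (x ∷ X)  ≡⟨ numDyckOfType≡pairCount (x ∷ X) 0<n ⟩
  pairCount 1 0 (x ∷ X) n  ≡⟨ pairCount≡motzkinFrom 0 X>0 ⟩
  motzkinFrom 0 (length X) ≡⟨ motzkin≡motzkinFrom (length X) ⟨
  motzkin (length X)       ∎
  where open ≡-Reasoning
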